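{- Let $G$ be a $(2n)$-vertex $(r,t)$-RS graph, $X\in\{0,1\}^{r\times t}$, $j\in[t]$, $\mathcal U$ a collection of vertex-disjoint $k$-sequences on $L(M_j)$, and $A=\mathrm{AugGraph}(G,X,j,\mathcal U)$. Then there is a matching $M^*$ of size $4n-2r$ in $A$ that does not match any of the vertices in $\mathrm{aug}(A)$.
   Context: A bipartite graph $G=(L,R,E)$ with $|L|=|R|=n$ is called $(2n)$-vertex. A matching is induced if the subgraph induced on its vertices is the matching itself. $G$ is an $(r,t)$-RS graph if its edges are partitioned into $t$ induced matchings $M_1,\dots,M_t$, each of size $r$; fix an ordering $e_{1,j},\dots,e_{r,j}$ of the edges of each $M_j$. $M(u)$ denotes the partner of $u$ in matching $M$. Encoded-RS graph: $H=\mathrm{EncodedRS}(G,X)$ has two vertices $a_v,b_v$ per vertex $v$ of $G$; for $e_{i,j}=(u,v)$ with $u\in L$, it contains $(a_u,a_v),(b_u,b_v)$ if $X_{i,j}=0$ and $(a_u,b_v),(b_u,a_v)$ if $X_{i,j}=1$. The edges coming from $M_j$ form the matching $\mathrm{rep}(M_j)$. For a sequence $\vec u=(u_1,\dots,u_k)$, $k\ge2$, of distinct vertices of $L(M_j)$, with $v_i=M_j(u_i)$, the augmenting edges are $(a_{v_i},a_{u_{i+1}}),(b_{v_i},b_{u_{i+1}})$, $i\in[k-1]$ (these are not edges of $H$), and the augmenting path $AP(\vec u)$ is the unique path starting at $\mathrm{start}(AP(\vec u))=a_{u_1}$ that alternately uses an edge of $\mathrm{rep}(M_j)$ and an augmenting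 edge, ending at $\mathrm{end}(AP(\vec u))\in\{a_{v_k},b_{v_k}\}$. A collection $\mathcal U=(\vec u_1,\dots,\vec u_\ell)$ of $k$-sequences is vertex-disjoint if all vertices used across all sequences are distinct. The augmentation graph $A=\mathrm{AugGraph}(G,X,j,\mathcal U)$ consists of the vertices of $H$ plus new vertex sets $P$ and $Q$, with the edges of $H$ together with: all augmenting edges of all $\vec u_i\in\mathcal U$; a perfect matching between $P$ and the vertices of $H$ not matched by $\mathrm{rep}(M_j)$; and a perfect matching between $Q$ and the vertices $\mathrm{start}(AP(\vec u_i))$, $\vec u_i\in\mathcal U$. With $\vec u_i=(u_{i,1},\dots,u_{i,k})$ and $v_{i,k}=M_j(u_{i,k})$, define $\mathrm{aug}(A)=\{a_{v_{i,k}}: a_{v_{i,k}}=\mathrm{end}(AP(\vec u_i))\}$ and $\overline{\mathrm{aug}}(A)=\{a_{v_{i,k}}: a_{v_{i,k}}\ne\mathrm{end}(AP(\vec u_i))\}$. -}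

module Defs where

open import Data.Nat using (ℕ; zero; suc)
open import Data.Fin using (Fin; toℕ; _≟_)
open import Data.Fin.Properties using (any?)
open import Data.Bool using (Bool; true; false; not; _xor_; T)
open import Data.Product using (Σ; ∃; ∃₂; _×_; _,_; proj₁; proj₂)
open import Data.Sum using (_⊎_; inj₁; inj₂)
open import Data.List using (List; []; _∷_; map; allFin; concatMap)
open import Data.List.Relation.Unary.All using (All)
open import Data.List.Relation.Unary.Unique.Propositional using (Unique)
open import Data.List.Membership.Propositional using (_∉_)
open import Relation.Nullary.Decidable using (⌊_⌋)
open import Relation.Binary.PropositionalEquality using (_≡_)

-- A (2n)-vertex bipartite graph G with L = R = Fin n, given together with
-- a partition of its edges into t matchings M_1..M_t of size r, each with a
-- fixed ordering:  e i j = e_{i,j} = (u , v) with u ∈ L, v ∈ R.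

EdgeG : ∀ {n r t} → (Fin r → Fin t → Fin n × Fin n) → Fin n → Fin n → Set
EdgeG e u v = ∃₂ λ i j → e i j ≡ (u , v)

record IsRSGraph {n r t : ℕ} (e : Fin r → Fin t → Fin n × Fin n) : Set where
  field
    distinct  : ∀ i j i' j' → e i j ≡ e i' j' → (i ≡ i') × (j ≡ j')
    matchingL : ∀ j i i' → proj₁ (e i j) ≡ proj₁ (e i' j) → i ≡ i'
    matchingR : ∀ j i i' → proj₂ (e i j) ≡ proj₂ (e i' j) → i ≡ i'
    -- induced (G bipartite, so only L–R pairs matter): if u_i ∈ L(M_j) and
    -- v_{i'} ∈ R(M_j) are adjacent in G then i = i'.
    induced   : ∀ j i i' → EdgeG e (proj₁ (e i j)) (proj₂ (e i' j)) → i ≡ i'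

-- Vertices of H = EncodedRS(G,X): a copy bit (false = a, true = b) and a
-- vertex of G (inj₁ = L side, inj₂ = R side).

HV : ℕ → Set
HV n = Bool × (Fin n ⊎ Fin n)

-- Edges of H: for e_{i,j} = (u,v): (a_u,a_v),(b_u,b_v) if X_{i,j} = 0 (false)
-- and (a_u,b_v),(b_u,a_v) if X_{i,j} = 1 (true); i.e. (c_u , (c xor X_{i,j})_v).
data HEdge {n r t : ℕ} (e : Fin r → Fin t → Fin n × Fin n)
           (X : Fin r → Fin t → Bool) : HV n → HV n → Set where
  hedge : ∀ i j c → HEdge e X (c , inj₁ (proj₁ (e i j))) (c xor X i j , inj₂ (proj₂ (e i j)))

repMatchedᵇ : ∀ {n r t} → (Fin r → Fin t → Fin n × Fin n) → Fin t → HV n → Bool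
repMatchedᵇ e j (c , inj₁ u) = ⌊ any? (λ i → proj₁ (e i j) ≟ u) ⌋
repMatchedᵇ e j (c , inj₂ v) = ⌊ any? (λ i → proj₂ (e i j) ≟ v) ⌋

-- Collection U = (u_1,..,u_ℓ) of k-sequences on L(M_j):
--   seq s m = u_{s,m} ∈ Fin n, and mem s m witnesses u_{s,m} ∈ L(M_j),
--   i.e. u_{s,m} = u-endpoint of e_{idx,j}.

Mem : ∀ {n r t} → (Fin r → Fin t → Fin n × Fin n) → Fin t →
      ∀ {ℓ k} → (Fin ℓ → Fin k → Fin n) → Set
Mem {r = r} e j {ℓ} {k} seq = ∀ (s : Fin ℓ) (m : Fin k) → Σ (Fin r) λ i → proj₁ (e i j) ≡ seq s m

VertexDisjoint : ∀ {n ℓ k} → (Fin ℓ → Fin k → Fin n) → Set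
VertexDisjoint seq = ∀ s m s' m' → seq s m ≡ seq s' m' → (s ≡ s') × (m ≡ m')

module AugGraph {n r t : ℕ} (e : Fin r → Fin t → Fin n × Fin n)
                (X : Fin r → Fin t → Bool) (j : Fin t)
                {ℓ k : ℕ} (seq : Fin ℓ → Fin k → Fin n) (mem : Mem e j seq) where

  idx : Fin ℓ → Fin k → Fin r
  idx s m = proj₁ (mem s m)

  vv : Fin ℓ → Fin k → Fin n
  vv s m = proj₂ (e (idx s m) j)

  data AugEdge : HV n → HV n → Set where
    augedge : ∀ s (m m' : Fin k) → toℕ m' ≡ suc (toℕ m) → ∀ c →
              AugEdge (c , inj₂ (vv s m)) (c , inj₁ (seq s m'))

  -- Following AP(u_s): we are at copy c of u_{s,m}; the rep(M_j) edge leads to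
  -- copy (c xor X) of v_{s,m}; if more vertices follow, the augmenting edge
  -- leads to the same copy of u_{s,m+1}.
  walk : Bool → List (Fin r) → Bool
  walk c []           = c
  walk c (i ∷ [])     = c xor X i j
  walk c (i ∷ i' ∷ is) = walk (c xor X i j) (i' ∷ is)

  -- copy (false = a, true = b) of end(AP(u_s)); the path starts at a_{u_{s,1}}
  endCopy : Fin ℓ → Bool
  endCopy s = walk false (map (idx s) (allFin k))

  -- vertices of A: vertices of H, P (one per H-vertex unmatched by rep(M_j)), Q
  data AV : Set where
    hv : HV n → AV
    pv : (x : HV n) → T (not (repMatchedᵇ e j x)) → AV
    qv : Fin ℓ → AV

  data AEdge : AV → AV → Set where
    hE : ∀ {x y} → HEdge e X x y → AEdge (hv x) (hv y)
    aE : ∀ {x y} → AugEdge x y → AEdge (hv x) (hv y)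
    pE : ∀ x (u : T (not (repMatchedᵇ e j x))) → AEdge (pv x u) (hv x)
    qE : ∀ s (m : Fin k) → toℕ m ≡ 0 → AEdge (qv s) (hv (false , inj₁ (seq s m)))

  Adj : AV → AV → Set
  Adj x y = AEdge x y ⊎ AEdge y x

  endpoints : List (AV × AV) → List AV
  endpoints = concatMap (λ p → proj₁ p ∷ proj₂ p ∷ [])

  -- a matching of A, given as a list of edges (pairs of adjacent vertices)
  -- whose endpoints are pairwise distinct; its size is the list length.
  IsMatching : List (AV × AV) → Set
  IsMatching M = All (λ p → Adj (proj₁ p) (proj₂ p)) M × Unique (endpoints M)

  -- M does not match any vertex of aug(A) = { a_{v_{s,k}} : end(AP(u_s)) = a_{v_{s,k}} }
  AvoidsAug : List (AV × AV) → Set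
  AvoidsAug M = ∀ s (m : Fin k) → suc (toℕ m) ≡ k → endCopy s ≡ false →
                hv (false , inj₂ (vv s m)) ∉ endpoints M

-- M* consists of the P-edges of the vertices of H unmatched by rep(M_j) and of one edge for each
-- copy c ∈ {a, b} of each edge e_{i,j} of M_j: that copy itself, unless (c, u_i) lies on an
-- augmenting path AP(u_s) ending in aug(A), in which case it is the edge of Q ∪ AP(u_s) entering
-- (c, u_i).  Along those paths this is rep(M_j) ⊕ AP(u_s) plus the Q-edge at the start, and
-- |M*| = (4n − 4r) + 2r.  The edges are disjoint because every vertex determines the only edge of M*
-- that could cover it: (c, u_i) only the edge for (i, c), and (d, v_i) only the edge for
-- (i, d ⊕ X_{i,j}) or, on a path, the next edge along that path.  The last vertex a_{v_{s,k}} of a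
-- path ending in aug(A) has no next edge, so it stays uncovered.

module Submission where

open import Defs
open import Data.Nat using (ℕ; zero; suc; pred; _≤_; _*_; _∸_; _+_; s≤s)
open import Data.Nat.Properties using (+-suc; m+n∸m≡n; m∸n+n≡m; m+n∸n≡m)
open import Data.Nat.Solver using (module +-*-Solver)
open import Data.Fin using (Fin; zero; suc; toℕ; _≟_; inject₁; fromℕ)
open import Data.Fin.Properties using (any?; toℕ-inject₁; toℕ-fromℕ; toℕ-injective; injective⇒≤)
open import Data.Bool using (Bool; true; false; not; _xor_; T)
import Data.Bool as Bool
open import Data.List.Relation.Unary.All.Properties using () renaming (map⁺ to All-map⁺)
open import Data.Bool.Properties using (xor-assoc; xor-same; xor-identityʳ; T-irrelevant)
open import Data.Maybe using (Maybe; just; nothing)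
import Data.Maybe as Maybe
open import Data.Maybe.Properties using (just-injective)
open import Data.Product using (Σ; ∃; ∃₂; _×_; _,_; proj₁; proj₂)
open import Data.Sum using (_⊎_; inj₁; inj₂)
open import Data.Sum.Properties using (inj₁-injective; inj₂-injective)
open import Data.Empty using (⊥-elim)
open import Data.List using (List; []; _∷_; map; allFin; length; _++_; filter; tabulate; concatMap; cartesianProduct)
open import Data.List.Properties using (length-map; length-++; length-tabulate; map-tabulate; filter-++)
open import Data.List.Relation.Unary.All as All using ([]; _∷_)
open import Data.List.Relation.Unary.Any using (here; there)
open import Data.List.Relation.Unary.AllPairs using ([]; _∷_)
open import Data.List.Relation.Unary.Unique.Propositional using (Unique)
open import Data.List.Relation.Unary.Unique.Propositional.Properties
  using (map⁺; map⁻; filter⁺; allFin⁺; ++⁺; cartesianProduct⁺)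
open import Data.List.Relation.Binary.Disjoint.Propositional using (Disjoint)
open import Data.List.Membership.Propositional using (_∈_)
open import Data.List.Membership.Propositional.Properties using (∈-filter⁻; ∈-filter⁺; ∈-map⁺; ∈-map⁻; ∈-allFin)
open import Data.List.Membership.Propositional.Properties.WithK using (unique∧set⇒bag)
open import Data.List.Relation.Binary.BagAndSetEquality using (∼bag⇒↭)
open import Data.List.Relation.Binary.Permutation.Propositional.Properties using (↭-length)
open import Function using (_∘_; Injective)
open import Function.Bundles using (mk⇔)
open import Relation.Nullary using (Dec; yes; no; ¬_)
open import Relation.Nullary.Decidable using (⌊_⌋; T?; _×-dec_; toWitness; fromWitness; fromWitnessFalse; toWitnessFalse)
open import Relation.Unary using (Pred; Decidable)
open import Relation.Binary.PropositionalEquality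

xor-cancelʳ : ∀ a b → (a xor b) xor b ≡ a
xor-cancelʳ a b = trans (xor-assoc a b b) (trans (cong (a xor_) (xor-same b)) (xor-identityʳ a))

prefixXor : ∀ {k} → Bool → (Fin k → Bool) → Fin k → Bool
prefixXor c f zero    = c
prefixXor c f (suc m) = prefixXor (c xor f zero) (f ∘ suc) m

prefixXor-suc : ∀ {k} c (f : Fin (suc k) → Bool) (m : Fin k) →
                prefixXor c f (suc m) ≡ prefixXor c f (inject₁ m) xor f (inject₁ m)
prefixXor-suc c f zero    = refl
prefixXor-suc c f (suc m) = prefixXor-suc (c xor f zero) (f ∘ suc) m

module _ {a p} {A : Set a} {P : Pred A p} (P? : Decidable P) where

  filter-Σ : List A → List (Σ A P)
  filter-Σ []       = []
  filter-Σ (x ∷ xs) with P? x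
  ... | yes px = (x , px) ∷ filter-Σ xs
  ... | no  _  = filter-Σ xs

  map-proj₁-filter-Σ : ∀ xs → map proj₁ (filter-Σ xs) ≡ filter P? xs
  map-proj₁-filter-Σ []       = refl
  map-proj₁-filter-Σ (x ∷ xs) with P? x
  ... | yes _ = cong (x ∷_) (map-proj₁-filter-Σ xs)
  ... | no  _ = map-proj₁-filter-Σ xs

  length-filter-Σ : ∀ xs → length (filter-Σ xs) ≡ length (filter P? xs)
  length-filter-Σ xs = trans (sym (length-map proj₁ (filter-Σ xs))) (cong length (map-proj₁-filter-Σ xs))

  filter-Σ⁺ : ∀ {xs} → Unique xs → Unique (filter-Σ xs)
  filter-Σ⁺ {xs} u = map⁻ (subst Unique (sym (map-proj₁-filter-Σ xs)) (filter⁺ P? u))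

  length-filter-++ : ∀ xs ys → length (filter P? (xs ++ ys)) ≡ length (filter P? xs) + length (filter P? ys)
  length-filter-++ xs ys = trans (cong length (filter-++ P? xs ys)) (length-++ (filter P? xs))

length-filter-map : ∀ {a b p} {A : Set a} {B : Set b} {P : Pred B p} (P? : Decidable P) (f : A → B) xs →
                    length (filter P? (map f xs)) ≡ length (filter (P? ∘ f) xs)
length-filter-map P? f []       = refl
length-filter-map P? f (x ∷ xs) with P? (f x)
... | yes _ = cong suc (length-filter-map P? f xs)
... | no  _ = length-filter-map P? f xs

length-filter-not : ∀ {a} {A : Set a} (f : A → Bool) xs →
                    length (filter (T? ∘ f) xs) + length (filter (T? ∘ not ∘ f) xs) ≡ length xs
length-filter-not f []       = refl
length-filter-not f (x ∷ xs) with f x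
... | true  = cong suc (length-filter-not f xs)
... | false = trans (+-suc _ _) (cong suc (length-filter-not f xs))

Disjoint-map : ∀ {a b c} {A : Set a} {B : Set b} {C : Set c} {f : A → C} {g : B → C} {xs ys} →
               (∀ x y → f x ≢ g y) → Disjoint (map f xs) (map g ys)
Disjoint-map {f = f} {g} f≢g (v∈fxs , v∈gys) with ∈-map⁻ f v∈fxs | ∈-map⁻ g v∈gys
... | x , _ , v≡fx | y , _ , v≡gy = f≢g x y (trans (sym v≡fx) v≡gy)

length-filter-cartesianProduct : ∀ {a b p} {A : Set a} {B : Set b} {P : Pred (A × B) p} (P? : Decidable P)
                                 xs ys {m} → (∀ x → length (filter (P? ∘ (x ,_)) ys) ≡ m) →
                                 length (filter P? (cartesianProduct xs ys)) ≡ length xs * m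
length-filter-cartesianProduct P? []       ys count = refl
length-filter-cartesianProduct P? (x ∷ xs) ys count =
  trans (length-filter-++ P? (map (x ,_) ys) (cartesianProduct xs ys))
        (cong₂ _+_ (trans (length-filter-map P? (x ,_) ys) (count x))
                   (length-filter-cartesianProduct P? xs ys count))

length-cartesianProduct : ∀ {a b} {A : Set a} {B : Set b} (xs : List A) (ys : List B) →
                          length (cartesianProduct xs ys) ≡ length xs * length ys
length-cartesianProduct []       ys = refl
length-cartesianProduct (x ∷ xs) ys =
  trans (length-++ (map (x ,_) ys)) (cong₂ _+_ (length-map (x ,_) ys) (length-cartesianProduct xs ys))

module _ {n r} (g : Fin r → Fin n) where

  inImage : Fin n → Bool
  inImage u = ⌊ any? (λ i → g i ≟ u) ⌋

  count-inImage : Injective _≡_ _≡_ g → length (filter (T? ∘ inImage) (allFin n)) ≡ r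
  count-inImage g-inj =
    trans (↭-length (∼bag⇒↭ (unique∧set⇒bag (filter⁺ _ (allFin⁺ n)) (map⁺ g-inj (allFin⁺ r)) (mk⇔ to from))))
          (trans (length-map g (allFin r)) (length-tabulate (λ i → i)))
    where
    to : ∀ {u} → u ∈ filter (T? ∘ inImage) (allFin n) → u ∈ map g (allFin r)
    to u∈ with toWitness (proj₂ (∈-filter⁻ (T? ∘ inImage) {xs = allFin n} u∈))
    ... | i , refl = ∈-map⁺ g (∈-allFin i)
    from : ∀ {u} → u ∈ map g (allFin r) → u ∈ filter (T? ∘ inImage) (allFin n)
    from {u} u∈ with ∈-map⁻ g u∈
    ... | i , _ , u≡gi = ∈-filter⁺ (T? ∘ inImage) (∈-allFin u) (fromWitness (i , sym u≡gi))

  count-notInImage : Injective _≡_ _≡_ g → length (filter (T? ∘ not ∘ inImage) (allFin n)) ≡ n ∸ r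
  count-notInImage g-inj = begin
    outside                ≡⟨ m+n∸m≡n r outside ⟨
    r + outside ∸ r        ≡⟨ cong (λ m → m + outside ∸ r) (count-inImage g-inj) ⟨
    inside + outside ∸ r   ≡⟨ cong (_∸ r) (length-filter-not inImage (allFin n)) ⟩
    length (allFin n) ∸ r  ≡⟨ cong (_∸ r) (length-tabulate (λ i → i)) ⟩
    n ∸ r                  ∎
    where
    open ≡-Reasoning
    inside outside : ℕ
    inside  = length (filter (T? ∘ inImage) (allFin n))
    outside = length (filter (T? ∘ not ∘ inImage) (allFin n))

endpoints : ∀ {a} {A : Set a} → List (A × A) → List A
endpoints = concatMap (λ p → proj₁ p ∷ proj₂ p ∷ [])

module _ {a i} {A : Set a} {I : Set i} (F : I → A × A) (owner : A → Maybe I)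
         (owner-proj₁ : ∀ x → owner (proj₁ (F x)) ≡ just x)
         (owner-proj₂ : ∀ x → owner (proj₂ (F x)) ≡ just x) where

  owned : ∀ {w} xs → w ∈ endpoints (map F xs) → ∃ λ x → x ∈ xs × owner w ≡ just x
  owned (x ∷ xs) (here refl)         = x , here refl , owner-proj₁ x
  owned (x ∷ xs) (there (here refl)) = x , here refl , owner-proj₂ x
  owned (x ∷ xs) (there (there w∈))  = let y , y∈ , oy = owned xs w∈ in y , there y∈ , oy

  Unique-endpoints : (∀ x → proj₁ (F x) ≢ proj₂ (F x)) → ∀ {xs} → Unique xs → Unique (endpoints (map F xs))
  Unique-endpoints distinct {[]}     []            = []
  Unique-endpoints distinct {x ∷ xs} (x∉xs ∷ uxs) =
    All.tabulate first ∷ All.tabulate (notElsewhere (owner-proj₂ x)) ∷ Unique-endpoints distinct uxs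
    where
    notElsewhere : ∀ {v w} → owner v ≡ just x → w ∈ endpoints (map F xs) → v ≢ w
    notElsewhere ov w∈ refl = let y , y∈ , ow = owned xs w∈ in
      All.lookup x∉xs y∈ (just-injective (trans (sym ov) ow))
    first : ∀ {w} → w ∈ proj₂ (F x) ∷ endpoints (map F xs) → proj₁ (F x) ≢ w
    first (here refl) = distinct x
    first (there w∈)  = notElsewhere (owner-proj₁ x) w∈

next : ∀ {k} → Fin k → Maybe (Fin k)
next {suc zero}    zero    = nothing
next {suc (suc k)} zero    = just (suc zero)
next {suc (suc k)} (suc m) = Maybe.map suc (next m)

next-inject₁ : ∀ {k} (m : Fin k) → next (inject₁ m) ≡ just (suc m)
next-inject₁ {suc k}       zero    = refl
next-inject₁ {suc (suc k)} (suc m) = cong (Maybe.map suc) (next-inject₁ m)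

next-last : ∀ {k} (m : Fin k) → suc (toℕ m) ≡ k → next m ≡ nothing
next-last {suc zero}    zero    _  = refl
next-last {suc (suc k)} (suc m) eq = cong (Maybe.map suc) (next-last m (cong pred eq))

bools : List Bool
bools = false ∷ true ∷ []

bools⁺ : Unique bools
bools⁺ = ((λ ()) ∷ []) ∷ [] ∷ []

sides : ∀ n → List (Fin n ⊎ Fin n)
sides n = map inj₁ (allFin n) ++ map inj₂ (allFin n)

allVertices : ∀ n → List (HV n)
allVertices n = cartesianProduct bools (sides n)

allVertices⁺ : ∀ n → Unique (allVertices n)
allVertices⁺ n = cartesianProduct⁺ bools⁺
  (++⁺ (map⁺ inj₁-injective (allFin⁺ n)) (map⁺ inj₂-injective (allFin⁺ n)) (Disjoint-map (λ _ _ ())))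

module AugmentingMatching {n r t : ℕ} (e : Fin r → Fin t → Fin n × Fin n) (rs : IsRSGraph e)
                          (X : Fin r → Fin t → Bool) (j : Fin t) {ℓ k : ℕ}
                          (seq : Fin ℓ → Fin (suc k) → Fin n) (mem : Mem e j seq)
                          (disjoint : VertexDisjoint seq) where

  open AugGraph e X j seq mem hiding (endpoints)
  open IsRSGraph rs

  left right : Fin r → Fin n
  left  i = proj₁ (e i j)
  right i = proj₂ (e i j)

  left-injective : Injective _≡_ _≡_ left
  left-injective = matchingL j _ _

  right-injective : Injective _≡_ _≡_ right
  right-injective = matchingR j _ _

  left-idx : ∀ s m → left (idx s m) ≡ seq s m
  left-idx s m = proj₂ (mem s m)

  idx-injective : ∀ {s m s' m'} → idx s m ≡ idx s' m' → s ≡ s' × m ≡ m'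
  idx-injective {s} {m} {s'} {m'} eq =
    disjoint s m s' m' (trans (sym (left-idx s m)) (trans (cong left eq) (left-idx s' m')))

  -- AP(u_s) visits u_{s,m} in the copy `copy s m` (false = a) and v_{s,m} in `copy s m xor X (idx s m) j`.
  copy : Fin ℓ → Fin (suc k) → Bool
  copy s = prefixXor false (λ m → X (idx s m) j)

  copy-suc : ∀ s m → copy s (suc m) ≡ copy s (inject₁ m) xor X (idx s (inject₁ m)) j
  copy-suc s = prefixXor-suc false (λ m → X (idx s m) j)

  walk-tabulate : ∀ {k'} c (g : Fin (suc k') → Fin r) →
                  walk c (tabulate g) ≡ prefixXor c (λ m → X (g m) j) (fromℕ k') xor X (g (fromℕ k')) j
  walk-tabulate {zero}   c g = refl
  walk-tabulate {suc k'} c g = walk-tabulate (c xor X (g zero) j) (g ∘ suc)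

  endCopy-last : ∀ s m → suc (toℕ m) ≡ suc k → endCopy s ≡ copy s m xor X (idx s m) j
  endCopy-last s m last with toℕ-injective {i = m} {j = fromℕ k} (trans (cong pred last) (sym (toℕ-fromℕ k)))
  ... | refl = trans (cong (walk false) (map-tabulate (λ m → m) (idx s))) (walk-tabulate false (idx s))

  OnAugPath : Fin r → Bool → Set
  OnAugPath i c = ∃₂ λ s m → idx s m ≡ i × endCopy s ≡ false × copy s m ≡ c

  onAugPath? : ∀ i c → Dec (OnAugPath i c)
  onAugPath? i c = any? λ s → any? λ m →
    (idx s m ≟ i) ×-dec (endCopy s Bool.≟ false) ×-dec (copy s m Bool.≟ c)

  Unmatched : Set
  Unmatched = Σ (HV n) λ x → T (not (repMatchedᵇ e j x))

  data Label : Set where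
    pendant : Unmatched → Label
    edge    : Fin r → Bool → Label

  predecessor : Fin ℓ → Fin (suc k) → AV
  predecessor s zero    = qv s
  predecessor s (suc m) = hv (copy s (suc m) , inj₂ (vv s (inject₁ m)))

  replaceRep : ∀ i c → Dec (OnAugPath i c) → AV × AV
  replaceRep i c (no _)            = hv (c xor X i j , inj₂ (right i)) , hv (c , inj₁ (left i))
  replaceRep i c (yes (s , m , _)) = predecessor s m , hv (copy s m , inj₁ (seq s m))

  edgeAt : Label → AV × AV
  edgeAt (pendant (x , p)) = pv x p , hv x
  edgeAt (edge i c)        = replaceRep i c (onAugPath? i c)

  replaceRep-distinct : ∀ i c D → proj₁ (replaceRep i c D) ≢ proj₂ (replaceRep i c D)
  replaceRep-distinct i c (no _)                ()
  replaceRep-distinct i c (yes (s , zero , _))  ()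
  replaceRep-distinct i c (yes (s , suc m , _)) ()

  edgeAt-distinct : ∀ a → proj₁ (edgeAt a) ≢ proj₂ (edgeAt a)
  edgeAt-distinct (pendant _) ()
  edgeAt-distinct (edge i c)  = replaceRep-distinct i c (onAugPath? i c)

  replaceRep-adjacent : ∀ i c D → Adj (proj₁ (replaceRep i c D)) (proj₂ (replaceRep i c D))
  replaceRep-adjacent i c (no _)                = inj₂ (hE (hedge i j c))
  replaceRep-adjacent i c (yes (s , zero , _))  = inj₁ (qE s zero refl)
  replaceRep-adjacent i c (yes (s , suc m , _)) =
    inj₁ (aE (augedge s (inject₁ m) (suc m) (cong suc (sym (toℕ-inject₁ m))) (copy s (suc m))))

  edgeAt-adjacent : ∀ a → Adj (proj₁ (edgeAt a)) (proj₂ (edgeAt a))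
  edgeAt-adjacent (pendant (x , p)) = inj₁ (pE x p)
  edgeAt-adjacent (edge i c)        = replaceRep-adjacent i c (onAugPath? i c)

  matchedL? : ∀ u → Dec (∃ λ i → left i ≡ u)
  matchedL? u = any? (λ i → left i ≟ u)

  matchedR? : ∀ v → Dec (∃ λ i → right i ≡ v)
  matchedR? v = any? (λ i → right i ≟ v)

  successorLabel : Fin ℓ → Fin (suc k) → Maybe Label
  successorLabel s m = Maybe.map (λ m' → edge (idx s m') (copy s m')) (next m)

  repEndOwner : ∀ i c → Dec (OnAugPath i c) → Maybe Label
  repEndOwner i c (no _)            = just (edge i c)
  repEndOwner i c (yes (s , m , _)) = successorLabel s m

  leftOwner : Bool → ∀ u → Dec (∃ λ i → left i ≡ u) → Maybe Label
  leftOwner c u (yes (i , _)) = just (edge i c)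
  leftOwner c u (no unm)      = just (pendant ((c , inj₁ u) , fromWitnessFalse {a? = matchedL? u} unm))

  rightOwner : Bool → ∀ v → Dec (∃ λ i → right i ≡ v) → Maybe Label
  rightOwner d v (yes (i , _)) = repEndOwner i (d xor X i j) (onAugPath? i (d xor X i j))
  rightOwner d v (no unm)      = just (pendant ((d , inj₂ v) , fromWitnessFalse {a? = matchedR? v} unm))

  owner : AV → Maybe Label
  owner (hv (c , inj₁ u)) = leftOwner c u (matchedL? u)
  owner (hv (d , inj₂ v)) = rightOwner d v (matchedR? v)
  owner (pv x p)          = just (pendant (x , p))
  owner (qv s)            = just (edge (idx s zero) false)

  owner-left : ∀ c i {u} → left i ≡ u → owner (hv (c , inj₁ u)) ≡ just (edge i c)
  owner-left c i {u} i↦u = go (matchedL? u)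
    where
    go : (D : Dec (∃ λ i' → left i' ≡ u)) → leftOwner c u D ≡ just (edge i c)
    go (yes (i' , i'↦u)) = cong (λ i → just (edge i c)) (matchingL j i' i (trans i'↦u (sym i↦u)))
    go (no unm)          = ⊥-elim (unm (i , i↦u))

  owner-right : ∀ d i → owner (hv (d , inj₂ (right i))) ≡ repEndOwner i (d xor X i j) (onAugPath? i (d xor X i j))
  owner-right d i = go (matchedR? (right i))
    where
    go : (D : Dec (∃ λ i' → right i' ≡ right i)) →
         rightOwner d (right i) D ≡ repEndOwner i (d xor X i j) (onAugPath? i (d xor X i j))
    go (yes (i' , eq)) with matchingR j i' i eq
    ... | refl = refl
    go (no unm) = ⊥-elim (unm (i , refl))

  owner-unmatched : ∀ x p → owner (hv x) ≡ just (pendant (x , p))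
  owner-unmatched (c , inj₁ u) p = go (matchedL? u)
    where
    go : (D : Dec (∃ λ i → left i ≡ u)) → leftOwner c u D ≡ just (pendant ((c , inj₁ u) , p))
    go (yes m)  = ⊥-elim (toWitnessFalse p m)
    go (no unm) = cong (λ p → just (pendant ((c , inj₁ u) , p))) (T-irrelevant _ _)
  owner-unmatched (d , inj₂ v) p = go (matchedR? v)
    where
    go : (D : Dec (∃ λ i → right i ≡ v)) → rightOwner d v D ≡ just (pendant ((d , inj₂ v) , p))
    go (yes m)  = ⊥-elim (toWitnessFalse p m)
    go (no unm) = cong (λ p → just (pendant ((d , inj₂ v) , p))) (T-irrelevant _ _)

  repEndOwner-off : ∀ i c → ¬ OnAugPath i c → (D : Dec (OnAugPath i c)) → repEndOwner i c D ≡ just (edge i c)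
  repEndOwner-off i c off (no _)   = refl
  repEndOwner-off i c off (yes on) = ⊥-elim (off on)

  repEndOwner-on : ∀ s m → endCopy s ≡ false → (D : Dec (OnAugPath (idx s m) (copy s m))) →
                    repEndOwner (idx s m) (copy s m) D ≡ successorLabel s m
  repEndOwner-on s m aug (no off) = ⊥-elim (off (s , m , refl , aug , refl))
  repEndOwner-on s m aug (yes (s' , m' , eq , _)) with idx-injective eq
  ... | refl , refl = refl

  replaceRep-owner₂ : ∀ i c D → owner (proj₂ (replaceRep i c D)) ≡ just (edge i c)
  replaceRep-owner₂ i c (no _)                          = owner-left c i refl
  replaceRep-owner₂ _ _ (yes (s , m , refl , _ , refl)) = owner-left (copy s m) (idx s m) (left-idx s m)

  replaceRep-owner₁ : ∀ i c D → owner (proj₁ (replaceRep i c D)) ≡ just (edge i c)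
  replaceRep-owner₁ i c (no off) = begin
    owner (hv (c xor X i j , inj₂ (right i)))                 ≡⟨ owner-right (c xor X i j) i ⟩
    repEndOwner i ((c xor X i j) xor X i j) (onAugPath? i _)  ≡⟨ cong (λ c → repEndOwner i c (onAugPath? i c)) (xor-cancelʳ c (X i j)) ⟩
    repEndOwner i c (onAugPath? i c)                          ≡⟨ repEndOwner-off i c off (onAugPath? i c) ⟩
    just (edge i c)                                           ∎
    where open ≡-Reasoning
  replaceRep-owner₁ _ _ (yes (s , zero , refl , _ , refl)) = refl
  replaceRep-owner₁ _ _ (yes (s , suc m , refl , aug , refl)) = begin
    owner (hv (copy s (suc m) , inj₂ (right i)))               ≡⟨ owner-right (copy s (suc m)) i ⟩
    repEndOwner i (copy s (suc m) xor X i j) (onAugPath? i _)  ≡⟨ cong (λ c → repEndOwner i c (onAugPath? i c)) exit ⟩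
    repEndOwner i (copy s (inject₁ m)) (onAugPath? i _)        ≡⟨ repEndOwner-on s (inject₁ m) aug (onAugPath? i _) ⟩
    successorLabel s (inject₁ m)                               ≡⟨ cong (Maybe.map _) (next-inject₁ m) ⟩
    just (edge (idx s (suc m)) (copy s (suc m)))               ∎
    where
    open ≡-Reasoning
    i = idx s (inject₁ m)
    exit : copy s (suc m) xor X i j ≡ copy s (inject₁ m)
    exit = trans (cong (_xor X i j) (copy-suc s m)) (xor-cancelʳ _ _)

  owner-proj₁ : ∀ a → owner (proj₁ (edgeAt a)) ≡ just a
  owner-proj₁ (pendant _) = refl
  owner-proj₁ (edge i c)  = replaceRep-owner₁ i c (onAugPath? i c)

  owner-proj₂ : ∀ a → owner (proj₂ (edgeAt a)) ≡ just a
  owner-proj₂ (pendant (x , p)) = owner-unmatched x p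
  owner-proj₂ (edge i c)        = replaceRep-owner₂ i c (onAugPath? i c)

  owner-aug : ∀ s m → suc (toℕ m) ≡ suc k → endCopy s ≡ false → owner (hv (false , inj₂ (vv s m))) ≡ nothing
  owner-aug s m last aug = begin
    owner (hv (false , inj₂ (right i)))        ≡⟨ owner-right false i ⟩
    repEndOwner i (X i j) (onAugPath? i _)     ≡⟨ cong (λ c → repEndOwner i c (onAugPath? i c)) exit ⟨
    repEndOwner i (copy s m) (onAugPath? i _)  ≡⟨ repEndOwner-on s m aug (onAugPath? i _) ⟩
    successorLabel s m                         ≡⟨ cong (Maybe.map _) (next-last m last) ⟩
    nothing                                    ∎
    where
    open ≡-Reasoning
    i = idx s m
    exit : copy s m ≡ X i j
    exit = trans (sym (xor-cancelʳ (copy s m) (X i j))) (cong (_xor X i j) (trans (sym (endCopy-last s m last)) aug))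

  unmatched? : Decidable (λ x → T (not (repMatchedᵇ e j x)))
  unmatched? x = T? (not (repMatchedᵇ e j x))

  unmatchedVertices : List Unmatched
  unmatchedVertices = filter-Σ unmatched? (allVertices n)

  repEdges : List (Bool × Fin r)
  repEdges = cartesianProduct bools (allFin r)

  labels : List Label
  labels = map pendant unmatchedVertices ++ map (λ (c , i) → edge i c) repEdges

  labels⁺ : Unique labels
  labels⁺ = ++⁺ (map⁺ (λ { refl → refl }) (filter-Σ⁺ unmatched? (allVertices⁺ n)))
                (map⁺ (λ { {_ , _} {_ , _} refl → refl }) (cartesianProduct⁺ bools⁺ (allFin⁺ r)))
                (Disjoint-map (λ _ _ ()))

  matching : List (AV × AV)
  matching = map edgeAt labels

  isMatching : IsMatching matching
  isMatching = All-map⁺ (All.universal edgeAt-adjacent labels) ,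
               Unique-endpoints edgeAt owner owner-proj₁ owner-proj₂ edgeAt-distinct labels⁺

  avoidsAug : AvoidsAug matching
  avoidsAug s m last aug w∈ with owned edgeAt owner owner-proj₁ owner-proj₂ labels w∈
  ... | _ , _ , owner-w with trans (sym owner-w) (owner-aug s m last aug)
  ... | ()

  count-unmatched : length unmatchedVertices ≡ 2 * ((n ∸ r) + (n ∸ r))
  count-unmatched = trans (length-filter-Σ unmatched? (allVertices n))
                          (length-filter-cartesianProduct unmatched? bools (sides n) perCopy)
    where
    perCopy : ∀ c → length (filter (unmatched? ∘ (c ,_)) (sides n)) ≡ (n ∸ r) + (n ∸ r)
    perCopy c = trans (length-filter-++ (unmatched? ∘ (c ,_)) (map inj₁ (allFin n)) (map inj₂ (allFin n)))
      (cong₂ _+_ (trans (length-filter-map (unmatched? ∘ (c ,_)) inj₁ (allFin n)) (count-notInImage left left-injective))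
                 (trans (length-filter-map (unmatched? ∘ (c ,_)) inj₂ (allFin n)) (count-notInImage right right-injective)))

  count-repEdges : length repEdges ≡ 2 * r
  count-repEdges = trans (length-cartesianProduct bools (allFin r)) (cong (2 *_) (length-tabulate {n = r} (λ i → i)))

  size : length matching ≡ 4 * n ∸ 2 * r
  size = begin
    length (map edgeAt labels)                    ≡⟨ length-map edgeAt labels ⟩
    length labels                                 ≡⟨ length-++ (map pendant unmatchedVertices) ⟩
    length (map pendant unmatchedVertices) + length (map _ repEdges)
                                                  ≡⟨ cong₂ _+_ (length-map pendant unmatchedVertices) (length-map _ repEdges) ⟩
    length unmatchedVertices + length repEdges    ≡⟨ cong₂ _+_ count-unmatched count-repEdges ⟩
    2 * (d + d) + 2 * r                           ≡⟨ m+n∸n≡m (2 * (d + d) + 2 * r) (2 * r) ⟨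
    2 * (d + d) + 2 * r + 2 * r ∸ 2 * r           ≡⟨ cong (_∸ 2 * r) (arithmetic d r) ⟩
    4 * (d + r) ∸ 2 * r                           ≡⟨ cong (λ m → 4 * m ∸ 2 * r) (m∸n+n≡m (injective⇒≤ left-injective)) ⟩
    4 * n ∸ 2 * r                                 ∎
    where
    open ≡-Reasoning
    open +-*-Solver
    d = n ∸ r
    arithmetic : ∀ d r → 2 * (d + d) + 2 * r + 2 * r ≡ 4 * (d + r)
    arithmetic = solve 2 (λ d r → con 2 :* (d :+ d) :+ con 2 :* r :+ con 2 :* r := con 4 :* (d :+ r)) refl

lemma3p7 : ∀ {n r t : ℕ} (e : Fin r → Fin t → Fin n × Fin n) → IsRSGraph e →
           (X : Fin r → Fin t → Bool) (j : Fin t) {ℓ k : ℕ} → 2 ≤ k →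
           (seq : Fin ℓ → Fin k → Fin n) (mem : Mem e j seq) → VertexDisjoint seq →
           Σ (List (AugGraph.AV e X j seq mem × AugGraph.AV e X j seq mem)) λ M →
             AugGraph.IsMatching e X j seq mem M × (length M ≡ 4 * n ∸ 2 * r) ×
             AugGraph.AvoidsAug e X j seq mem M
lemma3p7 e rs X j (s≤s _) seq mem disjoint = matching , isMatching , size , avoidsAug
  where open AugmentingMatching e rs X j seq mem disjoint
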